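{- Let $\mathscr{D}$ be a commutative variety of algebras, $X,Y$ objects of $\mathscr{D}$, and $L:X^{\circledast}\to Y$ a language. Then the syntactic $\mathscr{D}$-monoid of $L$ is isomorphic to the transition $\mathscr{D}$-monoid of the minimal $\mathscr{D}$-automaton for $L$: $\mathrm{Syn}\,L\cong\mathbb{T}(\mathrm{Min}\,L)$.
   Context: $\mathscr{D}$ commutative variety: the homomorphisms $A\to B$ form a subalgebra $[A,B]$ of $B^{|A|}$; $\mathscr{D}$ has tensor products $\otimes$ representing bimorphisms, unit $I=\Psi 1$, and is symmetric monoidal closed; $[Q,Q]$ is a $\mathscr{D}$-monoid under composition. A $\mathscr{D}$-monoid is an algebra with a monoid structure whose multiplication $\bullet$ is a bimorphism. $X^{\circledast}=\coprod_n X^{\otimes n}$ is the free $\mathscr{D}$-monoid on $X$, with unit $i_X$, multiplication $m_X$, universal arrow $\eta_X$. A language is a $\mathscr{D}$-morphism $L:X^{\circledast}\to Y$. A $\mathscr{D}$-automaton $(Q,\delta,i,f)$: $\delta:X\otimes Q\to Q$, $i:I\to Q$, $f:Q\to Y$; $e_Q:X^{\circledast}\to Q$ is the unique homomorphism of algebras for $FQ=I+X\otimes Q$ from the initial one $(X^{\circledast},[i_X,m_X\cdot(\eta_X\otimes X^{\circledast})])$; it accepts $f\cdot e_Q$. Let $(\lambda\delta)^+:X^{\circledast}\to[Q,Q]$ be the $\mathscr{D}$-monoid morphism extending the curried $\lambda\delta:X\to[Q,Q]$, and $\delta^{\circledast}:X^{\circledast}\otimes Q\to Q$ its uncurried form.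 The automaton is minimal if it is reachable ($e_Q$ surjective) and simple (the map $Q\to[X^{\circledast},Y]$, $q\mapsto(x\mapsto f(\delta^{\circledast}(x,q)))$, which is the unique coalgebra homomorphism into the final coalgebra for $TQ=Y\times[X,Q]$, is injective); every language is accepted by a minimal automaton $\mathrm{Min}\,L$, unique up to isomorphism. The transition $\mathscr{D}$-monoid $\mathbb{T}Q$ is the image of $(\lambda\delta)^+$ in $\mathbf{Mon}(\mathscr{D})$. A $\mathscr{D}$-monoid morphism $e:X^{\circledast}\to M$ recognizes $L$ if $L=g\cdot e$ for some $\mathscr{D}$-morphism $g:M\to Y$. The syntactic $\mathscr{D}$-monoid $\mathrm{Syn}\,L$ is the smallest $X$-generated $\mathscr{D}$-monoid (surjective $\mathscr{D}$-monoid morphism out of $X^{\circledast}$, ordered by factorization) recognizing $L$. -}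

module Defs where

open import Level using (0ℓ)
open import Data.Nat using (ℕ)
open import Data.Fin using (Fin)
open import Data.Product using (Σ; _×_; _,_; proj₁; proj₂; ∃; ∃-syntax)
open import Relation.Binary using (Setoid; IsEquivalence)

record Signature : Set₁ where
  field
    Op    : Set
    arity : Op → ℕ
open Signature public

data Term (S : Signature) (V : Set) : Set where
  var : V → Term S V
  op  : (σ : Op S) → (Fin (arity S σ) → Term S V) → Term S V

record Variety : Set₁ where
  field
    sig : Signature
    Eqn : Set
    lhs : Eqn → Term sig ℕ
    rhs : Eqn → Term sig ℕ
open Variety public

record Algebra (S : Signature) : Set₁ where
  field
    setoid : Setoid 0ℓ 0ℓ
  open Setoid setoid public
  field
    ⟦_⟧     : (σ : Op S) → (Fin (arity S σ) → Carrier) → Carrier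
    ⟦⟧-cong : ∀ σ {xs ys : Fin (arity S σ) → Carrier} →
              (∀ k → xs k ≈ ys k) → ⟦ σ ⟧ xs ≈ ⟦ σ ⟧ ys

  eval : ∀ {V : Set} → Term S V → (V → Carrier) → Carrier
  eval (var v)    ρ = ρ v
  eval (op σ ts)  ρ = ⟦ σ ⟧ (λ k → eval (ts k) ρ)

module _ {S : Signature} where

  record IsHom (A B : Algebra S) (f : Algebra.Carrier A → Algebra.Carrier B) : Set where
    private
      module A = Algebra A
      module B = Algebra B
    field
      cong : ∀ {x y} → x A.≈ y → f x B.≈ f y
      hom  : ∀ σ xs → f (A.⟦ σ ⟧ xs) B.≈ B.⟦ σ ⟧ (λ k → f (xs k))

  record Hom (A B : Algebra S) : Set where
    field
      fun   : Algebra.Carrier A → Algebra.Carrier B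
      isHom : IsHom A B fun
    open IsHom isHom public

  record Bimorphism (A B C : Algebra S) : Set where
    field
      app  : Algebra.Carrier A → Algebra.Carrier B → Algebra.Carrier C
      homˡ : ∀ b → IsHom A C (λ a → app a b)
      homʳ : ∀ a → IsHom B C (app a)

record DAlg (D : Variety) : Set₁ where
  field
    alg : Algebra (sig D)
  open Algebra alg public
  field
    sat : ∀ e (ρ : ℕ → Carrier) → eval (lhs D e) ρ ≈ eval (rhs D e) ρ


Commutative : Variety → Set₁
Commutative D =
  (A B : DAlg D) (σ : Op (sig D)) (hs : Fin (arity (sig D) σ) → Hom (DAlg.alg A) (DAlg.alg B)) →
  IsHom (DAlg.alg A) (DAlg.alg B) (λ a → DAlg.⟦_⟧ B σ (λ k → Hom.fun (hs k) a))

record DMonoid (D : Variety) : Set₁ where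
  field
    dalg : DAlg D
  open DAlg dalg public
  field
    ε     : Carrier
    mult  : Bimorphism (DAlg.alg dalg) (DAlg.alg dalg) (DAlg.alg dalg)
  _•_ : Carrier → Carrier → Carrier
  _•_ = Bimorphism.app mult
  field
    assoc     : ∀ x y z → (x • y) • z ≈ x • (y • z)
    identityˡ : ∀ x → ε • x ≈ x
    identityʳ : ∀ x → x • ε ≈ x

module _ {D : Variety} where

  record MonHom (M N : DMonoid D) : Set where
    private
      module M = DMonoid M
      module N = DMonoid N
    field
      homo  : Hom M.alg N.alg
    open Hom homo public
    field
      pres-ε : fun M.ε N.≈ N.ε
      pres-• : ∀ x y → fun (x M.• y) N.≈ (fun x N.• fun y)

  record FreeDMonoid (X : DAlg D) : Set₂ where
    field
      F      : DMonoid D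
      η      : Hom (DAlg.alg X) (DMonoid.alg F)
      extend : (M : DMonoid D) → Hom (DAlg.alg X) (DMonoid.alg M) → MonHom F M
      extend-η : ∀ M h x →
        DMonoid._≈_ M (MonHom.fun (extend M h) (Hom.fun η x)) (Hom.fun h x)
      extend-unique : ∀ M h (g : MonHom F M) →
        (∀ x → DMonoid._≈_ M (MonHom.fun g (Hom.fun η x)) (Hom.fun h x)) →
        ∀ w → DMonoid._≈_ M (MonHom.fun g w) (MonHom.fun (extend M h) w)

module Internal {D : Variety} (comm : Commutative D) (A B : DAlg D) where
  private
    module A = DAlg A
    module B = DAlg B

  homSetoid : Setoid 0ℓ 0ℓ
  homSetoid = record
    { Carrier = Hom A.alg B.alg
    ; _≈_ = λ f g → ∀ a → Hom.fun f a B.≈ Hom.fun g a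
    ; isEquivalence = record
      { refl  = λ a → B.refl
      ; sym   = λ p a → B.sym (p a)
      ; trans = λ p q a → B.trans (p a) (q a) } }

  homAlg : Algebra (sig D)
  homAlg = record
    { setoid  = homSetoid
    ; ⟦_⟧     = λ σ hs → record { fun = λ a → B.⟦ σ ⟧ (λ k → Hom.fun (hs k) a)
                                ; isHom = comm A B σ hs }
    ; ⟦⟧-cong = λ σ p a → B.⟦⟧-cong σ (λ k → p k a) }

  eval-pt : ∀ {V : Set} (t : Term (sig D) V) ρ a →
    Hom.fun (Algebra.eval homAlg t ρ) a B.≈ B.eval t (λ v → Hom.fun (ρ v) a)
  eval-pt (var v)   ρ a = B.refl
  eval-pt (op σ ts) ρ a = B.⟦⟧-cong σ (λ k → eval-pt (ts k) ρ a)

  [_,_] : DAlg D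
  [_,_] = record
    { alg = homAlg
    ; sat = λ e ρ a → B.trans (eval-pt (lhs D e) ρ a)
                        (B.trans (B.sat e (λ v → Hom.fun (ρ v) a))
                                 (B.sym (eval-pt (rhs D e) ρ a))) }

End : {D : Variety} → Commutative D → DAlg D → DMonoid D
End {D} comm Q = record
  { dalg = [_,_]
  ; ε    = idH
  ; mult = record
    { app  = _∘H_
    ; homˡ = λ g → record
      { cong = λ p q → p (Hom.fun g q)
      ; hom  = λ σ fs q → Q.refl }
    ; homʳ = λ f → record
      { cong = λ p q → Hom.cong f (p q)
      ; hom  = λ σ gs q → Hom.hom f σ (λ k → Hom.fun (gs k) q) } }
  ; assoc     = λ _ _ _ q → Q.refl
  ; identityˡ = λ _ q → Q.refl
  ; identityʳ = λ _ q → Q.refl }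
  where
    module Q = DAlg Q
    open Internal comm Q Q
    idH : Hom Q.alg Q.alg
    idH = record { fun = λ q → q ; isHom = record { cong = λ p → p ; hom = λ σ xs → Q.refl } }
    _∘H_ : Hom Q.alg Q.alg → Hom Q.alg Q.alg → Hom Q.alg Q.alg
    f ∘H g = record
      { fun = λ q → Hom.fun f (Hom.fun g q)
      ; isHom = record
        { cong = λ p → Hom.cong f (Hom.cong g p)
        ; hom  = λ σ xs → Q.trans (Hom.cong f (Hom.hom g σ xs))
                                  (Hom.hom f σ (λ k → Hom.fun g (xs k))) } }

module KernelQuotient {D : Variety} {M N : DMonoid D} (h : MonHom M N) where
  private
    module M = DMonoid M
    module N = DMonoid N
    module h = MonHom h
    ⟪_⟫ = h.fun

  kSetoid : Setoid 0ℓ 0ℓ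
  kSetoid = record
    { Carrier = M.Carrier
    ; _≈_ = λ x y → ⟪ x ⟫ N.≈ ⟪ y ⟫
    ; isEquivalence = record { refl = N.refl ; sym = N.sym ; trans = N.trans } }

  kAlg : Algebra (sig D)
  kAlg = record
    { setoid  = kSetoid
    ; ⟦_⟧     = M.⟦_⟧
    ; ⟦⟧-cong = λ σ {xs} {ys} p →
        N.trans (h.hom σ xs) (N.trans (N.⟦⟧-cong σ p) (N.sym (h.hom σ ys))) }

  eval-k : ∀ {V : Set} (t : Term (sig D) V) ρ →
    ⟪ Algebra.eval kAlg t ρ ⟫ N.≈ ⟪ M.eval t ρ ⟫
  eval-k (var v)   ρ = N.refl
  eval-k (op σ ts) ρ =
    N.trans (h.hom σ _) (N.trans (N.⟦⟧-cong σ (λ k → eval-k (ts k) ρ))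
                                 (N.sym (h.hom σ _)))

  kDAlg : DAlg D
  kDAlg = record
    { alg = kAlg
    ; sat = λ e ρ → N.trans (eval-k (lhs D e) ρ)
                      (N.trans (h.cong (M.sat e ρ)) (N.sym (eval-k (rhs D e) ρ))) }

  •-cong : ∀ {x y u v} → ⟪ x ⟫ N.≈ ⟪ y ⟫ → ⟪ u ⟫ N.≈ ⟪ v ⟫ →
           ⟪ x M.• u ⟫ N.≈ ⟪ y M.• v ⟫
  •-cong {x} {y} {u} {v} p q =
    N.trans (h.pres-• x u)
      (N.trans (N.trans (IsHom.cong (Bimorphism.homˡ N.mult _) p)
                        (IsHom.cong (Bimorphism.homʳ N.mult _) q))
               (N.sym (h.pres-• y v)))

  kMon : DMonoid D
  kMon = record
    { dalg = kDAlg
    ; ε    = M.ε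
    ; mult = record
      { app  = M._•_
      ; homˡ = λ b → record
        { cong = λ p → •-cong p N.refl
        ; hom  = λ σ xs → h.cong (IsHom.hom (Bimorphism.homˡ M.mult b) σ xs) }
      ; homʳ = λ a → record
        { cong = λ p → •-cong N.refl p
        ; hom  = λ σ xs → h.cong (IsHom.hom (Bimorphism.homʳ M.mult a) σ xs) } }
    ; assoc     = λ x y z → h.cong (M.assoc x y z)
    ; identityˡ = λ x → h.cong (M.identityˡ x)
    ; identityʳ = λ x → h.cong (M.identityʳ x) }

  quot : MonHom M kMon
  quot = record
    { homo = record { fun = λ x → x
                   ; isHom = record { cong = h.cong ; hom = λ σ xs → N.refl } }
    ; pres-ε = N.refl
    ; pres-• = λ x y → N.refl }

module _ {D : Variety} {X : DAlg D} (Fr : FreeDMonoid X) where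
  open FreeDMonoid Fr using (F)

  record XGen : Set₁ where
    field
      M    : DMonoid D
      e    : MonHom F M
      surj : ∀ m → ∃[ w ] DMonoid._≈_ M (MonHom.fun e w) m

  Language : DAlg D → Set
  Language Y = Hom (DMonoid.alg F) (DAlg.alg Y)

  Recognizes : {Y : DAlg D} → XGen → Language Y → Set
  Recognizes {Y} G L =
    Σ (Hom (DMonoid.alg (XGen.M G)) (DAlg.alg Y)) λ g →
      ∀ w → DAlg._≈_ Y (Hom.fun L w) (Hom.fun g (MonHom.fun (XGen.e G) w))

  _≤X_ : XGen → XGen → Set
  H ≤X G = Σ (MonHom (XGen.M G) (XGen.M H)) λ h →
    ∀ w → DMonoid._≈_ (XGen.M H) (MonHom.fun h (MonHom.fun (XGen.e G) w))
                                  (MonHom.fun (XGen.e H) w)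

  IsSyntactic : {Y : DAlg D} → Language Y → XGen → Set₁
  IsSyntactic {Y} L S = Recognizes {Y} S L × (∀ G → Recognizes {Y} G L → S ≤X G)

record Automaton {D : Variety} (X Y : DAlg D) : Set₁ where
  field
    Q : DAlg D
    δ : Bimorphism (DAlg.alg X) (DAlg.alg Q) (DAlg.alg Q)    -- δ : X ⊗ Q → Q
    i : DAlg.Carrier Q                          -- i : I → Q
    f : Hom (DAlg.alg Q) (DAlg.alg Y)

module AutomatonOps {D : Variety} (comm : Commutative D) {X Y : DAlg D}
                    (Fr : FreeDMonoid X) (A : Automaton X Y) where
  open Automaton A
  open FreeDMonoid Fr using (F; extend)
  private
    module Q = DAlg Q
    module Y = DAlg Y
    module X = DAlg X

  λδ : Hom (DAlg.alg X) (DMonoid.alg (End comm Q))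
  λδ = record
    { fun   = λ x → record { fun = Bimorphism.app δ x ; isHom = Bimorphism.homʳ δ x }
    ; isHom = record
      { cong = λ p q → IsHom.cong (Bimorphism.homˡ δ q) p
      ; hom  = λ σ xs q → IsHom.hom (Bimorphism.homˡ δ q) σ xs } }

  λδ⁺ : MonHom F (End comm Q)
  λδ⁺ = extend (End comm Q) λδ

  δ⊛ : DMonoid.Carrier F → Q.Carrier → Q.Carrier
  δ⊛ w q = Hom.fun (MonHom.fun λδ⁺ w) q

  eQ : DMonoid.Carrier F → Q.Carrier
  eQ w = δ⊛ w i

  Accepts : Language Fr Y → Set
  Accepts L = ∀ w → Hom.fun L w Y.≈ Hom.fun f (eQ w)

  Reachable : Set
  Reachable = ∀ q → ∃[ w ] eQ w Q.≈ q

  Simple : Set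
  Simple = ∀ q q' → (∀ w → Hom.fun f (δ⊛ w q) Y.≈ Hom.fun f (δ⊛ w q')) → q Q.≈ q'

  Minimal : Set
  Minimal = Reachable × Simple

  -- transition D-monoid 𝕋Q : image of (λδ)⁺ in Mon(D), as X-generated D-monoid
  𝕋 : XGen Fr
  𝕋 = record
    { M    = KernelQuotient.kMon λδ⁺
    ; e    = KernelQuotient.quot λδ⁺
    ; surj = λ m → m , λ q → Q.refl }

-- An X-generated D-monoid e : X^⊛ ↠ M recognizing L via g identifies only words that are
-- interchangeable in every context: e w ≈ e w' implies L(u w v) = L(u w' v) for all u, v.
-- In the minimal automaton, L(u w v) is the output of the state δ^⊛(w, e_Q v) after reading u,
-- so simplicity gives δ^⊛(w, e_Q v) = δ^⊛(w', e_Q v), and reachability turns this into equality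
-- of the transitions δ^⊛(w, -) and δ^⊛(w', -). Hence the kernel of e is contained in that of
-- (λδ)⁺, so 𝕋(Min L) is a quotient of M; it recognizes L via q ↦ f(q i).
module Submission where

open import Defs
open import Data.Product using (_,_; proj₁; proj₂)
import Relation.Binary.Reasoning.Setoid as SetoidReasoning

module DMonoidProperties {D : Variety} (M : DMonoid D) where
  open DMonoid M

  •-cong : ∀ {a b c d} → a ≈ b → c ≈ d → (a • c) ≈ (b • d)
  •-cong a≈b c≈d = trans (IsHom.cong (Bimorphism.homˡ mult _) a≈b)
                         (IsHom.cong (Bimorphism.homʳ mult _) c≈d)

module XGenProperties {D : Variety} {X : DAlg D} (Fr : FreeDMonoid X) where
  open FreeDMonoid Fr using (F)
  private
    module F = DMonoid F

  ≤X-fromKernel⊆ : (G H : XGen Fr) →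
    (∀ w w' → DMonoid._≈_ (XGen.M G) (MonHom.fun (XGen.e G) w) (MonHom.fun (XGen.e G) w') →
              DMonoid._≈_ (XGen.M H) (MonHom.fun (XGen.e H) w) (MonHom.fun (XGen.e H) w')) →
    _≤X_ Fr H G
  ≤X-fromKernel⊆ G H ker⊆ = h , λ w → ker⊆ _ _ (preimage-correct (eG.fun w))
    where
      module M = DMonoid (XGen.M G)
      module N = DMonoid (XGen.M H)
      module eG = MonHom (XGen.e G)
      module eH = MonHom (XGen.e H)
      open DMonoidProperties (XGen.M G)

      preimage : M.Carrier → F.Carrier
      preimage m = proj₁ (XGen.surj G m)

      preimage-correct : ∀ m → eG.fun (preimage m) M.≈ m
      preimage-correct m = proj₂ (XGen.surj G m)

      section : M.Carrier → N.Carrier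
      section m = eH.fun (preimage m)

      section-cong : ∀ {w m} → eG.fun w M.≈ m → eH.fun w N.≈ section m
      section-cong {w} {m} p = ker⊆ _ _ (M.trans p (M.sym (preimage-correct m)))

      h : MonHom (XGen.M G) (XGen.M H)
      h = record
        { homo = record
          { fun   = section
          ; isHom = record
            { cong = λ {m} m≈m' → section-cong (M.trans (preimage-correct m) m≈m')
            ; hom  = λ σ ms → N.trans
                (N.sym (section-cong (M.trans (eG.hom σ (λ k → preimage (ms k)))
                                              (M.⟦⟧-cong σ (λ k → preimage-correct (ms k))))))
                (eH.hom σ (λ k → preimage (ms k))) } }
        ; pres-ε = N.trans (N.sym (section-cong eG.pres-ε)) eH.pres-ε
        ; pres-• = λ x y → N.trans
            (N.sym (section-cong (M.trans (eG.pres-• (preimage x) (preimage y))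
                                          (•-cong (preimage-correct x) (preimage-correct y)))))
            (eH.pres-• (preimage x) (preimage y)) }

  SyntacticallyEquivalent : {Y : DAlg D} → Language Fr Y → F.Carrier → F.Carrier → Set
  SyntacticallyEquivalent {Y} L w w' =
    ∀ u v → DAlg._≈_ Y (Hom.fun L (u F.• (w F.• v))) (Hom.fun L (u F.• (w' F.• v)))

  recognizes⇒syntacticallyEquivalent : {Y : DAlg D} (G : XGen Fr) (L : Language Fr Y) →
    Recognizes Fr {Y} G L → ∀ w w' →
    DMonoid._≈_ (XGen.M G) (MonHom.fun (XGen.e G) w) (MonHom.fun (XGen.e G) w') →
    SyntacticallyEquivalent {Y} L w w'
  recognizes⇒syntacticallyEquivalent {Y} G L (g , L≈g∘e) w w' ew≈ew' u v = begin
    Hom.fun L (u F.• (w F.• v))              ≈⟨ L≈g∘e _ ⟩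
    Hom.fun g (e (u F.• (w F.• v)))          ≈⟨ Hom.cong g (e-context w) ⟩
    Hom.fun g (e u M.• (e w M.• e v))        ≈⟨ Hom.cong g (•-cong M.refl (•-cong ew≈ew' M.refl)) ⟩
    Hom.fun g (e u M.• (e w' M.• e v))       ≈⟨ Hom.cong g (e-context w') ⟨
    Hom.fun g (e (u F.• (w' F.• v)))         ≈⟨ L≈g∘e _ ⟨
    Hom.fun L (u F.• (w' F.• v))             ∎
    where
      open SetoidReasoning (DAlg.setoid Y)
      module M = DMonoid (XGen.M G)
      open DMonoidProperties (XGen.M G)
      e = MonHom.fun (XGen.e G)

      e-context : ∀ x → e (u F.• (x F.• v)) M.≈ (e u M.• (e x M.• e v))
      e-context x = M.trans (MonHom.pres-• (XGen.e G) u (x F.• v))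
                            (•-cong M.refl (MonHom.pres-• (XGen.e G) x v))

module AutomatonProperties {D : Variety} (comm : Commutative D) {X Y : DAlg D}
                           (Fr : FreeDMonoid X) (A : Automaton X Y) where
  open FreeDMonoid Fr using (F)
  open Automaton A
  open AutomatonOps comm Fr A
  open XGenProperties Fr using (SyntacticallyEquivalent)
  private
    module Q = DAlg Q
    module Y = DAlg Y
    module F = DMonoid F

  δ⊛-cong : ∀ w {q q'} → q Q.≈ q' → δ⊛ w q Q.≈ δ⊛ w q'
  δ⊛-cong w = Hom.cong (MonHom.fun λδ⁺ w)

  δ⊛-• : ∀ w v q → δ⊛ (w F.• v) q Q.≈ δ⊛ w (δ⊛ v q)
  δ⊛-• = MonHom.pres-• λδ⁺

  accepts-in-context : (L : Language Fr Y) → Accepts L → ∀ u w v →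
    Hom.fun f (δ⊛ u (δ⊛ w (eQ v))) Y.≈ Hom.fun L (u F.• (w F.• v))
  accepts-in-context L acc u w v = Y.sym (Y.trans (acc _) (Hom.cong f (Q.trans
    (δ⊛-• u (w F.• v) i) (δ⊛-cong u (δ⊛-• w v i)))))

  𝕋-recognizes : (L : Language Fr Y) → Accepts L → Recognizes Fr {Y} 𝕋 L
  𝕋-recognizes L acc = output , acc
    where
      output : Hom (DMonoid.alg (XGen.M 𝕋)) (DAlg.alg Y)
      output = record
        { fun   = λ w → Hom.fun f (eQ w)
        ; isHom = record
          { cong = λ p → Hom.cong f (p i)
          ; hom  = λ σ ws → Y.trans (Hom.cong f (MonHom.hom λδ⁺ σ ws i))
                                    (Hom.hom f σ (λ k → eQ (ws k))) } }

  minimal-syntacticallyEquivalent⇒δ⊛-equal : (L : Language Fr Y) → Minimal → Accepts L →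
    ∀ w w' → SyntacticallyEquivalent {Y} L w w' → ∀ q → δ⊛ w q Q.≈ δ⊛ w' q
  minimal-syntacticallyEquivalent⇒δ⊛-equal L (reachable , simple) acc w w' w∼w' q
    with reachable q
  ... | v , eQv≈q =
    Q.trans (δ⊛-cong w (Q.sym eQv≈q))
      (Q.trans on-reachable (δ⊛-cong w' eQv≈q))
    where
      on-reachable : δ⊛ w (eQ v) Q.≈ δ⊛ w' (eQ v)
      on-reachable = simple _ _ λ u →
        Y.trans (accepts-in-context L acc u w v)
          (Y.trans (w∼w' u v) (Y.sym (accepts-in-context L acc u w' v)))

theorem49 : (D : Variety) (comm : Commutative D) (X Y : DAlg D)
            (Fr : FreeDMonoid X) (L : Language Fr Y) (A : Automaton X Y) →
            AutomatonOps.Minimal comm Fr A →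
            AutomatonOps.Accepts comm Fr A L →
            IsSyntactic Fr {Y} L (AutomatonOps.𝕋 comm Fr A)
theorem49 D comm X Y Fr L A minimal acc =
  𝕋-recognizes L acc , λ G recG →
    ≤X-fromKernel⊆ G 𝕋 λ w w' ew≈ew' →
      minimal-syntacticallyEquivalent⇒δ⊛-equal L minimal acc w w'
        (recognizes⇒syntacticallyEquivalent {Y} G L recG w w' ew≈ew')
  where
    open XGenProperties Fr
    open AutomatonProperties comm Fr A
    open AutomatonOps comm Fr A using (𝕋)
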